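{- Let $m\neq 0$ and $r$ be real numbers, let $k\ge 0$, and let $\alpha_0,\alpha_1,\dots$ be real numbers such that $\alpha_0,\dots,\alpha_k$ are pairwise distinct. Then the exponential generating function of the generalized $r$-Whitney numbers of the second kind satisfies \[ \sum_{n= k}^{\infty}W_{m,r;\overline{\alpha}}(n,k)\frac{t^n}{n!}=\sum_{i=0}^{k}\frac{e^{(r+m\alpha_i)t}}{\prod_{j=0,\,j\neq i}^{k}(m\alpha_i-m\alpha_j)} \] (as formal power series in $t$, equivalently for all real $t$).
   Context: For a real sequence $\overline{\alpha}=(\alpha_0,\alpha_1,\dots)$ write $(x;\overline{\alpha})_n=\prod_{i=0}^{n-1}(x-\alpha_i)$, with $(x;\overline{\alpha})_0=1$. The generalized $r$-Whitney numbers of the second kind $W_{m,r;\overline{\alpha}}(n,k)$, $0\le k\le n$, are the unique real numbers such that, as polynomials in $x$, \[ (mx+r)^n=\sum_{k=0}^{n}W_{m,r;\overline{\alpha}}(n,k)\,m^k(x;\overline{\alpha})_k , \] and $W_{m,r;\overline{\alpha}}(n,k)=0$ for $k>n$. -}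

module Defs where

open import Level using (Level; _⊔_) renaming (suc to lsuc)
open import Data.Nat using (ℕ; zero; suc; _<_; _≤?_; _≟_)
open import Data.Nat using () renaming (_! to fact)
open import Data.Product using (_×_)
open import Relation.Nullary using (¬_; yes; no)
open import Algebra.Bundles using (CommutativeRing)

fromℕ : ∀ {c ℓ} (R : CommutativeRing c ℓ) → ℕ → CommutativeRing.Carrier R
fromℕ R zero    = CommutativeRing.0# R
fromℕ R (suc n) = CommutativeRing._+_ R (CommutativeRing.1# R) (fromℕ R n)

-- A field of characteristic zero (the real numbers are one).
-- The inverse is a total function, constrained only on nonzero elements.
record CharZeroField (c ℓ : Level) : Set (lsuc (c ⊔ ℓ)) where
  field
    commutativeRing : CommutativeRing c ℓ
  open CommutativeRing commutativeRing public
  field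
    _⁻¹         : Carrier → Carrier
    ⁻¹-cong     : ∀ {x y} → x ≈ y → x ⁻¹ ≈ y ⁻¹
    ⁻¹-inverseʳ : ∀ x → ¬ (x ≈ 0#) → x * (x ⁻¹) ≈ 1#
    0≉1         : ¬ (0# ≈ 1#)
    charZero    : ∀ n → ¬ (fromℕ commutativeRing (suc n) ≈ 0#)

module WithField {c ℓ : Level} (F : CharZeroField c ℓ) where
  open CharZeroField F public

  pow : Carrier → ℕ → Carrier
  pow x zero    = 1#
  pow x (suc n) = pow x n * x

  sumTo : ℕ → (ℕ → Carrier) → Carrier
  sumTo zero    f = 0#
  sumTo (suc n) f = sumTo n f + f n

  prodTo : ℕ → (ℕ → Carrier) → Carrier
  prodTo zero    f = 1#
  prodTo (suc n) f = prodTo n f * f n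

  poch : Carrier → (ℕ → Carrier) → ℕ → Carrier
  poch x α n = prodTo n (λ i → x - α i)

  factF : ℕ → Carrier
  factF n = fromℕ commutativeRing (fact n)

  IsWhitney2 : Carrier → Carrier → (ℕ → Carrier) → (ℕ → ℕ → Carrier) → Set (c ⊔ ℓ)
  IsWhitney2 m r α W =
    (∀ n k → n < k → W n k ≈ 0#) ×
    (∀ n x → pow (m * x + r) n ≈ sumTo (suc n) (λ k → W n k * pow m k * poch x α k))

  -- formal power series in t: the sequence of coefficients of t^n
  Series : Set c
  Series = ℕ → Carrier

  expS : Carrier → Series
  expS a n = pow a n * (factF n ⁻¹)

  scaleS : Carrier → Series → Series
  scaleS a f n = a * f n

  sumS : ℕ → (ℕ → Series) → Series
  sumS k f n = sumTo k (λ i → f i n)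

  _≈S_ : Series → Series → Set ℓ
  f ≈S g = ∀ n → f n ≈ g n

  whitneyEGF : (ℕ → ℕ → Carrier) → ℕ → Series
  whitneyEGF W k n with k ≤? n
  ... | yes _ = W n k * (factF n ⁻¹)
  ... | no  _ = 0#

  denom : Carrier → (ℕ → Carrier) → ℕ → ℕ → Carrier
  denom m α k i = prodTo (suc k) factor
    where
      factor : ℕ → Carrier
      factor j with j ≟ i
      ... | yes _ = 1#
      ... | no  _ = m * α i - m * α j

  rhsEGF : Carrier → Carrier → (ℕ → Carrier) → ℕ → Series
  rhsEGF m r α k = sumS (suc k) (λ i → scaleS (denom m α k i ⁻¹) (expS (r + m * α i)))

module Submission where

-- Comparing coefficients of t^n, the identity says that W(n,k) is the k-th
-- divided difference of y ↦ (r + y)^n at the nodes x_i = m α_i: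
--   W(n,k) = Σ_{i ≤ k} (r + x_i)^n / ∏_{t ≤ k, t ≠ i} (x_i - x_t).
-- Evaluating the defining identity at α_l (l ≤ k) gives the lower-triangular
-- system (r + x_l)^n = Σ_{j ≤ l} W(n,j) ω_j(x_l) in the Newton basis
-- ω_j(y) = ∏_{t < j} (y - x_t), whose diagonal is nonzero for distinct nodes.
-- Newton's interpolation formula (proved by exchanging a double sum and a
-- telescoping identity) says the divided differences solve the same system,
-- so uniqueness for triangular systems identifies the two.

open import Defs
open import Level using (Level)
open import Data.Nat using (ℕ; zero; suc; _≤_; _<_; _≤?_; _≟_; z≤n; s≤s)
open import Data.Nat.Properties
  using (≤-refl; ≤-trans; ≤-pred; n≤1+n; n<1+n; <⇒≤; <⇒≢; <⇒≱; ≰⇒>; m<n⇒m<1+n; ≤-total;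
         m≤n⇒m<n∨m≡n)
open import Data.Nat.Induction using (<-rec)
open import Data.Sum using (_⊎_; inj₁; inj₂)
open import Data.Product using (proj₁; proj₂)
open import Data.Empty using (⊥-elim)
open import Relation.Nullary using (¬_; yes; no)
open import Relation.Binary.PropositionalEquality as P using (_≡_; _≢_)
import Relation.Binary.Reasoning.Setoid as SetoidReasoning

module Development {c ℓ : Level} (F : CharZeroField c ℓ) where
  open WithField F hiding (zero)
  open SetoidReasoning setoid
  open import Algebra.Properties.Ring ring using (x[y-z]≈xy-xz)
  open import Algebra.Properties.Group +-group using (x∙y⁻¹≈ε⇒x≈y) renaming (∙-cancelˡ to +-cancelˡ)
  open import Algebra.Solver.Ring.NaturalCoefficients.Default commutativeSemiring
    using (solve; _:=_; _:*_; _:+_)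

  +-exchange : ∀ a b c d → (a + b) + (c + d) ≈ (c + b) + (a + d)
  +-exchange = solve 4 (λ a b c d → (a :+ b) :+ (c :+ d) := (c :+ b) :+ (a :+ d)) refl

  +-interchange : ∀ a b c d → (a + b) + (c + d) ≈ (a + c) + (b + d)
  +-interchange = solve 4 (λ a b c d → (a :+ b) :+ (c :+ d) := (a :+ c) :+ (b :+ d)) refl

  *-rotate : ∀ a b c → (a * b) * c ≈ (a * c) * b
  *-rotate = solve 3 (λ a b c → (a :* b) :* c := (a :* c) :* b) refl

  *-interchange : ∀ a b c d → (a * b) * (c * d) ≈ (a * c) * (b * d)
  *-interchange = solve 4 (λ a b c d → (a :* b) :* (c :* d) := (a :* c) :* (b :* d)) refl

  *-shuffle : ∀ a b c → (a * b) * c ≈ b * (c * a)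
  *-shuffle = solve 3 (λ a b c → (a :* b) :* c := b :* (c :* a)) refl

  sub-telescope : ∀ x y z → (y - z) + (x - y) ≈ x - z
  sub-telescope x y z = begin
    (y - z) + (x - y)   ≈⟨ +-exchange y (- z) x (- y) ⟩
    (x - z) + (y - y)   ≈⟨ +-congˡ (-‿inverseʳ y) ⟩
    (x - z) + 0#        ≈⟨ +-identityʳ (x - z) ⟩
    x - z               ∎

  1≉0 : ¬ (1# ≈ 0#)
  1≉0 1≈0 = 0≉1 (sym 1≈0)

  *-cancelʳ-nonzero : ∀ {x y z} → ¬ (y ≈ 0#) → x * y ≈ z * y → x ≈ z
  *-cancelʳ-nonzero {x} {y} {z} y≉0 xy≈zy = begin
    x                 ≈⟨ *-identityʳ x ⟨
    x * 1#            ≈⟨ *-congˡ (⁻¹-inverseʳ y y≉0) ⟨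
    x * (y * y ⁻¹)    ≈⟨ *-assoc x y (y ⁻¹) ⟨
    (x * y) * y ⁻¹    ≈⟨ *-congʳ xy≈zy ⟩
    (z * y) * y ⁻¹    ≈⟨ *-assoc z y (y ⁻¹) ⟩
    z * (y * y ⁻¹)    ≈⟨ *-congˡ (⁻¹-inverseʳ y y≉0) ⟩
    z * 1#            ≈⟨ *-identityʳ z ⟩
    z                 ∎

  *-nonzero : ∀ {x y} → ¬ (x ≈ 0#) → ¬ (y ≈ 0#) → ¬ (x * y ≈ 0#)
  *-nonzero {x} {y} x≉0 y≉0 xy≈0 =
    y≉0 (*-cancelʳ-nonzero x≉0 (trans (*-comm y x) (trans xy≈0 (sym (zeroˡ x)))))

  ⁻¹-* : ∀ {x y} → ¬ (x ≈ 0#) → ¬ (y ≈ 0#) → (x * y) ⁻¹ ≈ x ⁻¹ * y ⁻¹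
  ⁻¹-* {x} {y} x≉0 y≉0 = *-cancelʳ-nonzero xy≉0 (begin
    (x * y) ⁻¹ * (x * y)        ≈⟨ *-comm _ _ ⟩
    (x * y) * (x * y) ⁻¹        ≈⟨ ⁻¹-inverseʳ (x * y) xy≉0 ⟩
    1#                          ≈⟨ *-identityʳ 1# ⟨
    1# * 1#                     ≈⟨ *-cong (⁻¹-inverseʳ x x≉0) (⁻¹-inverseʳ y y≉0) ⟨
    (x * x ⁻¹) * (y * y ⁻¹)     ≈⟨ *-interchange x (x ⁻¹) y (y ⁻¹) ⟩
    (x * y) * (x ⁻¹ * y ⁻¹)     ≈⟨ *-comm _ _ ⟩
    (x ⁻¹ * y ⁻¹) * (x * y)     ∎)
    where xy≉0 = *-nonzero x≉0 y≉0

  partial-fraction : ∀ {d e} a u → ¬ (d ≈ 0#) → ¬ (e ≈ 0#) →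
    a * d ⁻¹ + (a * u) * (d * e) ⁻¹ ≈ (a * (e + u)) * (d * e) ⁻¹
  partial-fraction {d} {e} a u d≉0 e≉0 = begin
    a * d ⁻¹ + (a * u) * (d * e) ⁻¹
      ≈⟨ +-cong a/d≈ae/de refl ⟩
    (a * e) * (d * e) ⁻¹ + (a * u) * (d * e) ⁻¹
      ≈⟨ distribʳ _ (a * e) (a * u) ⟨
    (a * e + a * u) * (d * e) ⁻¹
      ≈⟨ *-congʳ (distribˡ a e u) ⟨
    (a * (e + u)) * (d * e) ⁻¹ ∎
    where
    a/d≈ae/de : a * d ⁻¹ ≈ (a * e) * (d * e) ⁻¹
    a/d≈ae/de = begin
      a * d ⁻¹                     ≈⟨ *-identityʳ _ ⟨
      (a * d ⁻¹) * 1#              ≈⟨ *-congˡ (⁻¹-inverseʳ e e≉0) ⟨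
      (a * d ⁻¹) * (e * e ⁻¹)      ≈⟨ *-interchange a (d ⁻¹) e (e ⁻¹) ⟩
      (a * e) * (d ⁻¹ * e ⁻¹)      ≈⟨ *-congˡ (⁻¹-* d≉0 e≉0) ⟨
      (a * e) * (d * e) ⁻¹         ∎

  pow-cong : ∀ {x y} n → x ≈ y → pow x n ≈ pow y n
  pow-cong zero    x≈y = refl
  pow-cong (suc n) x≈y = *-cong (pow-cong n x≈y) x≈y

  sumTo-cong : ∀ n {f g : ℕ → Carrier} → (∀ j → j < n → f j ≈ g j) → sumTo n f ≈ sumTo n g
  sumTo-cong zero    f≈g = refl
  sumTo-cong (suc n) f≈g = +-cong (sumTo-cong n (λ j j<n → f≈g j (m<n⇒m<1+n j<n))) (f≈g n (n<1+n n))

  sumTo-zero : ∀ n {f : ℕ → Carrier} → (∀ j → j < n → f j ≈ 0#) → sumTo n f ≈ 0#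
  sumTo-zero n f≈0 = trans (sumTo-cong n f≈0) (zeros n)
    where
    zeros : ∀ n → sumTo n (λ _ → 0#) ≈ 0#
    zeros zero    = refl
    zeros (suc n) = trans (+-identityʳ _) (zeros n)

  sumTo-*ˡ : ∀ n a (f : ℕ → Carrier) → a * sumTo n f ≈ sumTo n (λ j → a * f j)
  sumTo-*ˡ zero    a f = zeroʳ a
  sumTo-*ˡ (suc n) a f = trans (distribˡ a (sumTo n f) (f n)) (+-congʳ (sumTo-*ˡ n a f))

  sumTo-*ʳ : ∀ n a (f : ℕ → Carrier) → sumTo n f * a ≈ sumTo n (λ j → f j * a)
  sumTo-*ʳ n a f =
    trans (*-comm _ a) (trans (sumTo-*ˡ n a f) (sumTo-cong n (λ j _ → *-comm a (f j))))

  sumTo-+ : ∀ n (f g : ℕ → Carrier) → sumTo n (λ j → f j + g j) ≈ sumTo n f + sumTo n g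
  sumTo-+ zero    f g = sym (+-identityʳ 0#)
  sumTo-+ (suc n) f g =
    trans (+-congʳ (sumTo-+ n f g)) (+-interchange (sumTo n f) (sumTo n g) (f n) (g n))

  sumTo-swap : ∀ a b (h : ℕ → ℕ → Carrier) →
    sumTo a (λ j → sumTo b (h j)) ≈ sumTo b (λ i → sumTo a (λ j → h j i))
  sumTo-swap zero    b h = sym (sumTo-zero b (λ _ _ → refl))
  sumTo-swap (suc a) b h =
    trans (+-congʳ (sumTo-swap a b h)) (sym (sumTo-+ b (λ i → sumTo a (λ j → h j i)) (h a)))

  sumTo-zero-tail : ∀ {a b} {f : ℕ → Carrier} → a ≤ b →
    (∀ j → a ≤ j → j < b → f j ≈ 0#) → sumTo b f ≈ sumTo a f
  sumTo-zero-tail {b = zero}  z≤n tail = refl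
  sumTo-zero-tail {a} {suc b} {f} a≤1+b tail with m≤n⇒m<n∨m≡n a≤1+b
  ... | inj₂ P.refl = refl
  ... | inj₁ a<1+b  = begin
    sumTo b f + f b    ≈⟨ +-congˡ (tail b a≤b (n<1+n b)) ⟩
    sumTo b f + 0#     ≈⟨ +-identityʳ _ ⟩
    sumTo b f          ≈⟨ sumTo-zero-tail a≤b (λ j a≤j j<b → tail j a≤j (m<n⇒m<1+n j<b)) ⟩
    sumTo a f          ∎
    where a≤b = ≤-pred a<1+b

  prodTo-cong : ∀ n {f g : ℕ → Carrier} → (∀ j → j < n → f j ≈ g j) → prodTo n f ≈ prodTo n g
  prodTo-cong zero    f≈g = refl
  prodTo-cong (suc n) f≈g = *-cong (prodTo-cong n (λ j j<n → f≈g j (m<n⇒m<1+n j<n))) (f≈g n (n<1+n n))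

  prodTo-nonzero : ∀ n (f : ℕ → Carrier) → (∀ j → j < n → ¬ (f j ≈ 0#)) → ¬ (prodTo n f ≈ 0#)
  prodTo-nonzero zero    f f≉0 = 1≉0
  prodTo-nonzero (suc n) f f≉0 =
    *-nonzero (prodTo-nonzero n f (λ j j<n → f≉0 j (m<n⇒m<1+n j<n))) (f≉0 n (n<1+n n))

  omit : (ℕ → Carrier) → ℕ → ℕ → Carrier
  omit f i j with j ≟ i
  ... | yes _ = 1#
  ... | no  _ = f j

  omit-self : ∀ f i → omit f i i ≈ 1#
  omit-self f i with i ≟ i
  ... | yes _   = refl
  ... | no  i≢i = ⊥-elim (i≢i P.refl)

  omit-other : ∀ f i j → j ≢ i → omit f i j ≈ f j
  omit-other f i j j≢i with j ≟ i
  ... | yes j≡i = ⊥-elim (j≢i j≡i)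
  ... | no  _   = refl

  prodTo-omit-last : ∀ n f → prodTo (suc n) (omit f n) ≈ prodTo n f
  prodTo-omit-last n f = begin
    prodTo n (omit f n) * omit f n n
      ≈⟨ *-cong (prodTo-cong n (λ j j<n → omit-other f n j (<⇒≢ j<n))) (omit-self f n) ⟩
    prodTo n f * 1#                    ≈⟨ *-identityʳ _ ⟩
    prodTo n f                         ∎

  prodTo-omit : ∀ n f i → i < n → prodTo n f ≈ prodTo n (omit f i) * f i
  prodTo-omit (suc n) f i i<1+n with m≤n⇒m<n∨m≡n (≤-pred i<1+n)
  ... | inj₂ P.refl = *-congʳ (sym (prodTo-omit-last n f))
  ... | inj₁ i<n    = begin
    prodTo n f * f n                           ≈⟨ *-congʳ (prodTo-omit n f i i<n) ⟩
    (prodTo n (omit f i) * f i) * f n          ≈⟨ *-rotate _ _ _ ⟩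
    (prodTo n (omit f i) * f n) * f i
      ≈⟨ *-congʳ (*-congˡ (omit-other f i n (λ n≡i → <⇒≢ i<n (P.sym n≡i)))) ⟨
    (prodTo n (omit f i) * omit f i n) * f i   ∎

  prodTo-zero : ∀ n f i → i < n → f i ≈ 0# → prodTo n f ≈ 0#
  prodTo-zero n f i i<n fi≈0 =
    trans (prodTo-omit n f i i<n) (trans (*-congˡ fi≈0) (zeroʳ _))

  Distinct : (ℕ → Carrier) → ℕ → Set ℓ
  Distinct x k = ∀ i j → i ≤ k → j ≤ k → i ≢ j → ¬ (x i ≈ x j)

  module Interpolation (x : ℕ → Carrier) where

    ω : ℕ → ℕ → Carrier
    ω l j = prodTo j (λ t → x l - x t)

    omitted : ℕ → ℕ → ℕ → Carrier
    omitted l L i = prodTo (suc L) (omit (λ t → x l - x t) i)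

    denomAt : ℕ → ℕ → Carrier
    denomAt L i = omitted i L i

    dividedDiff : (ℕ → Carrier) → ℕ → Carrier
    dividedDiff v j = sumTo (suc j) (λ i → denomAt j i ⁻¹ * v i)

    ω-last : ∀ l L → omitted l L L ≈ ω l L
    ω-last l L = prodTo-omit-last L (λ t → x l - x t)

    ω-vanishes : ∀ l j → l < j → ω l j ≈ 0#
    ω-vanishes l j l<j = prodTo-zero j (λ t → x l - x t) l l<j (-‿inverseʳ (x l))

    -- The weight of v_i in the j-th Newton term at the node x_l.
    weight : ℕ → ℕ → ℕ → Carrier
    weight l i j with i ≤? j
    ... | yes _ = ω l j * denomAt j i ⁻¹
    ... | no  _ = 0#

    weight-≤ : ∀ l i j → i ≤ j → weight l i j ≈ ω l j * denomAt j i ⁻¹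
    weight-≤ l i j i≤j with i ≤? j
    ... | yes _   = refl
    ... | no  i≰j = ⊥-elim (i≰j i≤j)

    weight-> : ∀ l i j → j < i → weight l i j ≈ 0#
    weight-> l i j j<i with i ≤? j
    ... | yes i≤j = ⊥-elim (<⇒≱ j<i i≤j)
    ... | no  _   = refl

    newton-term : ∀ v l j → j ≤ l →
      dividedDiff v j * ω l j ≈ sumTo (suc l) (λ i → v i * weight l i j)
    newton-term v l j j≤l = begin
      dividedDiff v j * ω l j
        ≈⟨ sumTo-*ʳ (suc j) (ω l j) (λ i → denomAt j i ⁻¹ * v i) ⟩
      sumTo (suc j) (λ i → (denomAt j i ⁻¹ * v i) * ω l j)
        ≈⟨ sumTo-cong (suc j) (λ i i<1+j →
             trans (*-shuffle _ _ _) (*-congˡ (sym (weight-≤ l i j (≤-pred i<1+j))))) ⟩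
      sumTo (suc j) (λ i → v i * weight l i j)
        ≈⟨ sumTo-zero-tail (s≤s j≤l)
             (λ i j<i _ → trans (*-congˡ (weight-> l i j j<i)) (zeroʳ _)) ⟨
      sumTo (suc l) (λ i → v i * weight l i j) ∎

    module Distinct-nodes (k : ℕ) (distinct : Distinct x k) where

      gap-nonzero : ∀ {i j} → i ≤ k → j ≤ k → i ≢ j → ¬ (x i - x j ≈ 0#)
      gap-nonzero i≤k j≤k i≢j gap≈0 = distinct _ _ i≤k j≤k i≢j (x∙y⁻¹≈ε⇒x≈y _ _ gap≈0)

      denomAt-nonzero : ∀ L i → L ≤ k → i ≤ k → ¬ (denomAt L i ≈ 0#)
      denomAt-nonzero L i L≤k i≤k = prodTo-nonzero (suc L) _ factor-nonzero
        where
        factor-nonzero : ∀ j → j < suc L → ¬ (omit (λ t → x i - x t) i j ≈ 0#)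
        factor-nonzero j j<1+L with j ≟ i
        ... | yes _   = 1≉0
        ... | no  j≢i = gap-nonzero i≤k (≤-trans (≤-pred j<1+L) L≤k) (λ i≡j → j≢i (P.sym i≡j))

      ω-diagonal-nonzero : ∀ l → l ≤ k → ¬ (ω l l ≈ 0#)
      ω-diagonal-nonzero l l≤k ω≈0 = denomAt-nonzero l l l≤k l≤k (trans (ω-last l l) ω≈0)

      weights-partial : ∀ l i L → i ≤ L → L ≤ k →
        sumTo (suc L) (weight l i) ≈ omitted l L i * denomAt L i ⁻¹
      weights-partial l i L i≤L L≤k with m≤n⇒m<n∨m≡n i≤L
      weights-partial l i L i≤L L≤k | inj₂ P.refl = begin
        sumTo i (weight l i) + weight l i i
          ≈⟨ +-cong (sumTo-zero i (λ j j<i → weight-> l i j j<i)) (weight-≤ l i i ≤-refl) ⟩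
        0# + ω l i * denomAt i i ⁻¹    ≈⟨ +-identityˡ _ ⟩
        ω l i * denomAt i i ⁻¹         ≈⟨ *-congʳ (ω-last l i) ⟨
        omitted l i i * denomAt i i ⁻¹ ∎
      weights-partial l i (suc L) i≤1+L 1+L≤k | inj₁ i<1+L = begin
        sumTo (suc L) (weight l i) + weight l i (suc L)
          ≈⟨ +-cong (weights-partial l i L i≤L L≤k) (weight-≤ l i (suc L) i≤1+L) ⟩
        a * d ⁻¹ + ω l (suc L) * denomAt (suc L) i ⁻¹
          ≈⟨ +-congˡ (*-cong (prodTo-omit (suc L) (λ t → x l - x t) i i<1+L) (⁻¹-cong (omitted-step i))) ⟩
        a * d ⁻¹ + (a * (x l - x i)) * (d * e) ⁻¹
          ≈⟨ partial-fraction a (x l - x i) d≉0 e≉0 ⟩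
        (a * (e + (x l - x i))) * (d * e) ⁻¹
          ≈⟨ *-cong (*-congˡ (sub-telescope (x l) (x i) (x (suc L)))) (⁻¹-cong (sym (omitted-step i))) ⟩
        (a * (x l - x (suc L))) * denomAt (suc L) i ⁻¹
          ≈⟨ *-congʳ (omitted-step l) ⟨
        omitted l (suc L) i * denomAt (suc L) i ⁻¹ ∎
        where
        i≤L = ≤-pred i<1+L
        L≤k = ≤-trans (n≤1+n L) 1+L≤k
        a = omitted l L i
        d = denomAt L i
        e = x i - x (suc L)
        1+L≢i : suc L ≢ i
        1+L≢i 1+L≡i = <⇒≢ i<1+L (P.sym 1+L≡i)
        omitted-step : ∀ l′ → omitted l′ (suc L) i ≈ omitted l′ L i * (x l′ - x (suc L))
        omitted-step l′ = *-congˡ (omit-other (λ t → x l′ - x t) i (suc L) 1+L≢i)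
        d≉0 = denomAt-nonzero L i L≤k (≤-trans i≤L L≤k)
        e≉0 = gap-nonzero (≤-trans i≤L L≤k) 1+L≤k (λ i≡1+L → 1+L≢i (P.sym i≡1+L))

      -- Summed over all j ≤ l, the weights of v_i form the identity matrix.
      weights-off-diagonal : ∀ l i → i < l → l ≤ k → sumTo (suc l) (weight l i) ≈ 0#
      weights-off-diagonal l i i<l l≤k = begin
        sumTo (suc l) (weight l i)       ≈⟨ weights-partial l i l (<⇒≤ i<l) l≤k ⟩
        omitted l l i * denomAt l i ⁻¹   ≈⟨ *-congʳ omitted≈0 ⟩
        0# * denomAt l i ⁻¹              ≈⟨ zeroˡ _ ⟩
        0#                               ∎
        where
        omitted≈0 : omitted l l i ≈ 0#
        omitted≈0 = prodTo-zero (suc l) _ l (n<1+n l)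
          (trans (omit-other (λ t → x l - x t) i l (λ l≡i → <⇒≢ i<l (P.sym l≡i))) (-‿inverseʳ (x l)))

      weights-diagonal : ∀ l → l ≤ k → sumTo (suc l) (weight l l) ≈ 1#
      weights-diagonal l l≤k =
        trans (weights-partial l l l ≤-refl l≤k) (⁻¹-inverseʳ (denomAt l l) (denomAt-nonzero l l l≤k l≤k))

      newton : ∀ v l → l ≤ k → sumTo (suc l) (λ j → dividedDiff v j * ω l j) ≈ v l
      newton v l l≤k = begin
        sumTo (suc l) (λ j → dividedDiff v j * ω l j)
          ≈⟨ sumTo-cong (suc l) (λ j j<1+l → newton-term v l j (≤-pred j<1+l)) ⟩
        sumTo (suc l) (λ j → sumTo (suc l) (λ i → v i * weight l i j))
          ≈⟨ sumTo-swap (suc l) (suc l) (λ j i → v i * weight l i j) ⟩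
        sumTo (suc l) (λ i → sumTo (suc l) (λ j → v i * weight l i j))
          ≈⟨ sumTo-cong (suc l) (λ i _ → sumTo-*ˡ (suc l) (v i) (weight l i)) ⟨
        sumTo l (λ i → v i * sumTo (suc l) (weight l i)) + v l * sumTo (suc l) (weight l l)
          ≈⟨ +-cong (sumTo-zero l (λ i i<l → trans (*-congˡ (weights-off-diagonal l i i<l l≤k)) (zeroʳ _)))
                    (*-congˡ (weights-diagonal l l≤k)) ⟩
        0# + v l * 1#      ≈⟨ +-identityˡ _ ⟩
        v l * 1#           ≈⟨ *-identityʳ _ ⟩
        v l                ∎

  triangular-unique : ∀ (M : ℕ → ℕ → Carrier) (a b : ℕ → Carrier) k →
    (∀ l → l ≤ k → ¬ (M l l ≈ 0#)) →
    (∀ l → l ≤ k → sumTo (suc l) (λ j → a j * M l j) ≈ sumTo (suc l) (λ j → b j * M l j)) →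
    ∀ l → l ≤ k → a l ≈ b l
  triangular-unique M a b k diagonal≉0 same-rows = <-rec (λ l → l ≤ k → a l ≈ b l) step
    where
    step : ∀ l → (∀ {j} → j < l → j ≤ k → a j ≈ b j) → l ≤ k → a l ≈ b l
    step l earlier l≤k = *-cancelʳ-nonzero (diagonal≉0 l l≤k) (+-cancelˡ _ _ _ (begin
      sumTo l (λ j → b j * M l j) + a l * M l l
        ≈⟨ +-congʳ (sumTo-cong l (λ j j<l → *-congʳ (earlier j<l (≤-trans (<⇒≤ j<l) l≤k)))) ⟨
      sumTo (suc l) (λ j → a j * M l j)
        ≈⟨ same-rows l l≤k ⟩
      sumTo (suc l) (λ j → b j * M l j) ∎))

  module Whitney (m r : Carrier) (α : ℕ → Carrier) (W : ℕ → ℕ → Carrier)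
                 (isWhitney : IsWhitney2 m r α W) where

    x : ℕ → Carrier
    x t = m * α t

    open Interpolation x

    scaled-poch : ∀ y j → pow m j * poch y α j ≈ prodTo j (λ t → m * y - x t)
    scaled-poch y zero    = *-identityˡ 1#
    scaled-poch y (suc j) = begin
      (pow m j * m) * (poch y α j * (y - α j))    ≈⟨ *-interchange _ _ _ _ ⟩
      (pow m j * poch y α j) * (m * (y - α j))    ≈⟨ *-cong (scaled-poch y j) (x[y-z]≈xy-xz m y (α j)) ⟩
      prodTo j (λ t → m * y - x t) * (m * y - x j) ∎

    whitney-system : ∀ n l → sumTo (suc l) (λ j → W n j * ω l j) ≈ pow (r + x l) n
    whitney-system n l = begin
      sumTo (suc l) term          ≈⟨ truncate (≤-total n l) ⟨
      sumTo (suc n) term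
        ≈⟨ sumTo-cong (suc n) (λ j _ → trans (*-congˡ (sym (scaled-poch (α l) j))) (sym (*-assoc _ _ _))) ⟩
      sumTo (suc n) (λ j → W n j * pow m j * poch (α l) α j) ≈⟨ proj₂ isWhitney n (α l) ⟨
      pow (x l + r) n             ≈⟨ pow-cong n (+-comm (x l) r) ⟩
      pow (r + x l) n             ∎
      where
      term : ℕ → Carrier
      term j = W n j * ω l j
      truncate : (n ≤ l) ⊎ (l ≤ n) → sumTo (suc n) term ≈ sumTo (suc l) term
      truncate (inj₁ n≤l) = sym (sumTo-zero-tail (s≤s n≤l)
        (λ j n<j _ → trans (*-congʳ (proj₁ isWhitney n j n<j)) (zeroˡ _)))
      truncate (inj₂ l≤n) = sumTo-zero-tail (s≤s l≤n)
        (λ j l<j _ → trans (*-congˡ (ω-vanishes l j l<j)) (zeroʳ _))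

    whitney-dividedDiff : ∀ k → ¬ (m ≈ 0#) → Distinct α k →
      ∀ n l → l ≤ k → W n l ≈ dividedDiff (λ i → pow (r + x i) n) l
    whitney-dividedDiff k m≉0 α-distinct n =
      triangular-unique ω (W n) (dividedDiff v) k ω-diagonal-nonzero
        (λ l l≤k → trans (whitney-system n l) (sym (newton v l l≤k)))
      where
      v : ℕ → Carrier
      v i = pow (r + x i) n
      x-distinct : Distinct x k
      x-distinct i j i≤k j≤k i≢j mαi≈mαj =
        α-distinct i j i≤k j≤k i≢j
          (*-cancelʳ-nonzero m≉0 (trans (*-comm _ m) (trans mαi≈mαj (*-comm m _))))
      open Distinct-nodes k x-distinct

    -- The coefficient of t^n on the left is W(n,k)/n!, also when n < k.
    whitneyEGF-coefficient : ∀ k n → whitneyEGF W k n ≈ W n k * factF n ⁻¹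
    whitneyEGF-coefficient k n with k ≤? n
    ... | yes _   = refl
    ... | no  k≰n = sym (trans (*-congʳ (proj₁ isWhitney n k (≰⇒> k≰n))) (zeroˡ _))

    -- The factor function of a product, recovered by unification; used to
    -- name the (local) factors of denom.
    factorsOf : ∀ n {f : ℕ → Carrier} (p : Carrier) → p ≡ prodTo n f → ℕ → Carrier
    factorsOf _ {f} _ _ = f

    denom≈denomAt : ∀ L i → denom m α L i ≈ denomAt L i
    denom≈denomAt L i = prodTo-cong (suc L) (λ j _ → same-factor j)
      where
      same-factor : ∀ j → factorsOf (suc L) (denom m α L i) P.refl j ≈ omit (λ t → x i - x t) i j
      same-factor j with j ≟ i
      ... | yes _ = refl
      ... | no  _ = refl

    rhsEGF-coefficient : ∀ k n →
      rhsEGF m r α k n ≈ dividedDiff (λ i → pow (r + x i) n) k * factF n ⁻¹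
    rhsEGF-coefficient k n = begin
      sumTo (suc k) (λ i → denom m α k i ⁻¹ * (pow (r + x i) n * factF n ⁻¹))
        ≈⟨ sumTo-cong (suc k) (λ i _ →
             trans (*-congʳ (⁻¹-cong (denom≈denomAt k i))) (sym (*-assoc _ _ _))) ⟩
      sumTo (suc k) (λ i → (denomAt k i ⁻¹ * pow (r + x i) n) * factF n ⁻¹)
        ≈⟨ sumTo-*ʳ (suc k) (factF n ⁻¹) (λ i → denomAt k i ⁻¹ * pow (r + x i) n) ⟨
      dividedDiff (λ i → pow (r + x i) n) k * factF n ⁻¹ ∎

mainTheorem2 : ∀ {c ℓ : Level} (F : CharZeroField c ℓ) → let open WithField F in
    (m r : Carrier) (α : ℕ → Carrier) (k : ℕ) (W : ℕ → ℕ → Carrier) →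
    ¬ (m ≈ 0#) →
    (∀ i j → i ≤ k → j ≤ k → i ≢ j → ¬ (α i ≈ α j)) →
    IsWhitney2 m r α W →
    whitneyEGF W k ≈S rhsEGF m r α k
mainTheorem2 F m r α k W m≉0 α-distinct isWhitney n = begin
  whitneyEGF W k n                          ≈⟨ whitneyEGF-coefficient k n ⟩
  W n k * factF n ⁻¹                        ≈⟨ *-congʳ (whitney-dividedDiff k m≉0 α-distinct n k ≤-refl) ⟩
  dividedDiff (λ i → pow (r + x i) n) k * factF n ⁻¹ ≈⟨ rhsEGF-coefficient k n ⟨
  rhsEGF m r α k n                          ∎
  where
  open WithField F hiding (zero)
  open SetoidReasoning setoid
  open Development F
  open Whitney m r α W isWhitney
  open Interpolation x
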